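{- Let $n>0$ be an integer and let $a,b,c,d$ be natural numbers with $n^3 \leq a < b < c < d$. Then $$(ac-n)(bd-n) \geq \frac{abcd}{2}.$$ -}

module Defs where

{-# OPTIONS --safe #-}
module Submission where

open import Defs
open import Data.Nat using (ℕ; _+_; _*_; _∸_; _^_; _≤_; _<_; z≤n; s≤s; >-nonZero)
open import Data.Nat.Properties
open import Data.Nat.Solver using (module +-*-Solver)
open import Data.Product using (_,_)
open import Relation.Binary.PropositionalEquality using (_≡_; refl; sym; cong; module ≡-Reasoning)

open +-*-Solver using (solve; _:+_; _:*_; _:=_; con)

-- Expanding x = ac and y = bd around 2n turns the claim (x - n)(y - n) ≥ xy/2 into
-- uv ≥ 2n² for the offsets u = x - 2n and v = y - 2n; since a ≥ n³ ≥ n and the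
-- numbers are strictly increasing, u ≥ n² and v ≥ 2.

m≤m^[1+k] : ∀ m k → 0 < m → m ≤ m ^ (1 + k)
m≤m^[1+k] m k 0<m = ≤-trans (≤-reflexive (sym (^-identityʳ m))) (^-monoʳ-≤ m {{>-nonZero 0<m}} {1} {1 + k} (s≤s z≤n))

2*m+n∸m≡m+n : ∀ m n → 2 * m + n ∸ m ≡ m + n
2*m+n∸m≡m+n m n = begin
  2 * m + n ∸ m    ≡⟨ cong (_∸ m) (solve 2 (λ m n → con 2 :* m :+ n := m :+ (m :+ n)) refl m n) ⟩
  m + (m + n) ∸ m  ≡⟨ m+n∸m≡n m (m + n) ⟩
  m + n            ∎
  where open ≡-Reasoning

offset-product-≤-double : ∀ n u v → 2 * (n * n) ≤ u * v →
                          (2 * n + u) * (2 * n + v) ≤ 2 * ((n + u) * (n + v))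
offset-product-≤-double n u v 2n²≤uv = +-cancelʳ-≤ (2 * (n * n)) _ _ (begin
  (2 * n + u) * (2 * n + v) + 2 * (n * n)  ≤⟨ +-monoʳ-≤ _ 2n²≤uv ⟩
  (2 * n + u) * (2 * n + v) + u * v        ≡⟨ expand n u v ⟩
  2 * ((n + u) * (n + v)) + 2 * (n * n)    ∎)
  where
  open ≤-Reasoning
  expand : ∀ n u v → (2 * n + u) * (2 * n + v) + u * v ≡ 2 * ((n + u) * (n + v)) + 2 * (n * n)
  expand = solve 3 (λ n u v → (con 2 :* n :+ u) :* (con 2 :* n :+ v) :+ u :* v
                            := con 2 :* ((n :+ u) :* (n :+ v)) :+ con 2 :* (n :* n)) refl

product-≤-double-shifted-product : ∀ n x y → 2 * n + n * n ≤ x → 2 * n + 2 ≤ y →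
                                   x * y ≤ 2 * ((x ∸ n) * (y ∸ n))
product-≤-double-shifted-product n x y 2n+n²≤x 2n+2≤y
  with (u , refl) ← m≤n⇒∃[o]m+o≡n (≤-trans (m≤m+n (2 * n) _) 2n+n²≤x)
     | (v , refl) ← m≤n⇒∃[o]m+o≡n (≤-trans (m≤m+n (2 * n) _) 2n+2≤y)
  rewrite 2*m+n∸m≡m+n n u | 2*m+n∸m≡m+n n v
  = offset-product-≤-double n u v 2n²≤uv
  where
  2n²≤uv : 2 * (n * n) ≤ u * v
  2n²≤uv = ≤-trans (≤-reflexive (*-comm 2 (n * n)))
                   (*-mono-≤ (+-cancelˡ-≤ (2 * n) _ _ 2n+n²≤x) (+-cancelˡ-≤ (2 * n) _ _ 2n+2≤y))

lemma2p7 : (n a b c d : ℕ) → 0 < n → n ^ 3 ≤ a → a < b → b < c → c < d →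
           a * b * c * d ≤ 2 * ((a * c ∸ n) * (b * d ∸ n))
lemma2p7 n a b c d 0<n n³≤a a<b b<c c<d = begin
  a * b * c * d    ≡⟨ solve 4 (λ a b c d → a :* b :* c :* d := a :* c :* (b :* d)) refl a b c d ⟩
  a * c * (b * d)  ≤⟨ product-≤-double-shifted-product n (a * c) (b * d) 2n+n²≤ac 2n+2≤bd ⟩
  2 * ((a * c ∸ n) * (b * d ∸ n))  ∎
  where
  open ≤-Reasoning
  n≤a : n ≤ a
  n≤a = ≤-trans (m≤m^[1+k] n 2 0<n) n³≤a
  n<b : n < b
  n<b = ≤-<-trans n≤a a<b
  2n+n²≤ac : 2 * n + n * n ≤ a * c
  2n+n²≤ac = ≤-trans (≤-reflexive (solve 1 (λ n → con 2 :* n :+ n :* n := n :* (con 2 :+ n)) refl n))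
                     (*-mono-≤ n≤a (≤-trans (s≤s n<b) b<c))
  2n+2≤bd : 2 * n + 2 ≤ b * d
  2n+2≤bd = ≤-trans (≤-reflexive (solve 1 (λ n → con 2 :* n :+ con 2 := con 2 :* (con 1 :+ n)) refl n))
                    (*-mono-≤ (≤-trans (s≤s 0<n) n<b) (<-trans n<b (<-trans b<c c<d)))
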